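{- The space minor relation on 2-complexes is well-founded; that is, every strictly decreasing chain with respect to this relation is finite.
   Context: A 2-complex $C=(V,E,F)$ is a finite graph (loops and parallel edges allowed) with a finite set $F$ of faces, each a closed trail (cyclic sequence of distinct edges). The link graph $L(v)$ has as vertices the edges at $v$ (a loop contributes two) and, for each traversal of $v$ by a face, an edge joining the vertices corresponding to the face's edges just before and after the traversal. A space minor of a 2-complex is obtained by successively performing the following operations: (1) contracting an edge that is not a loop (identify its endvertices, remove it from all faces, delete it); (2) deleting a face (and all edges or vertices only incident with that face); (3) contracting a face of size one (delete it and remove its unique edge from all other faces) or a face of size two whose two edges are not loops (identify its two edges and delete the face); if afterwards a face traverses an edge twice consecutively in opposite directions these two traversals are omitted, and faces incident with no edge are deleted; (4) splitting a vertex $v$ (replace $v$ by one copy for each connected component of $L(v)$, each incidence inherited by the copy whose component contains the corresponding vertex or edge); (5) topologically deleting an edge $e$ (replace $e$ by parallel copies, one for each incident face, each such face using its own copy in place of $e$). -}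

module Defs where

open import Data.Nat using (ℕ; zero; suc)
open import Data.Fin using (Fin)
open import Data.Fin.Properties using () renaming (_≟_ to _≟F_)
open import Data.Bool using (Bool; true; false; not; if_then_else_)
open import Data.Bool.Properties using () renaming (_≟_ to _≟B_)
open import Data.Product using (Σ; ∃; _×_; _,_; proj₁; proj₂)
open import Data.Sum using (_⊎_)
open import Data.Empty using (⊥)
open import Data.List using (List; []; _∷_; map; length; lookup; removeAt; reverse; _++_; drop; take; zip; _∷ʳ_)
open import Data.List.Relation.Unary.All using (All)
open import Data.List.Relation.Unary.Linked using (Linked)
open import Data.List.Relation.Unary.Unique.Propositional using (Unique)
open import Data.List.Membership.Propositional using (_∈_; _∉_)
open import Relation.Nullary using (¬_; yes; no)
open import Relation.Binary.PropositionalEquality using (_≡_; _≢_)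
open import Relation.Binary.Construct.Closure.ReflexiveTransitive using (Star)
open import Relation.Binary.Construct.Closure.Symmetric using (SymClosure)
open import Function.Definitions using (Injective)

Bij : ∀ {m n} → (Fin m → Fin n) → Set
Bij f = Injective _≡_ _≡_ f × (∀ y → ∃ λ x → f x ≡ y)

-- An edge x has two ends, src x and tgt x (edges are undirected; the
-- choice of src/tgt is only a representation).  A traversal (x , true)
-- goes from src x to tgt x, (x , false) from tgt x to src x.
-- A face is a cyclic sequence of traversals, represented by a list
-- (any rotation, and the reversed sequence, represent the same face).

Trav : ℕ → Set
Trav n = Fin n × Bool

Face : ℕ → Set
Face n = List (Trav n)

module _ {nV nE : ℕ} (src tgt : Fin nE → Fin nV) where

  tailV : Trav nE → Fin nV
  tailV (x , b) = if b then src x else tgt x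

  headV : Trav nE → Fin nV
  headV (x , b) = if b then tgt x else src x

  ClosedWalk : Face nE → Set
  ClosedWalk []       = ⊥
  ClosedWalk (t ∷ ts) = Linked (λ s s′ → headV s ≡ tailV s′) ((t ∷ ts) ∷ʳ t)

  ClosedTrail : Face nE → Set
  ClosedTrail f = ClosedWalk f × Unique (map proj₁ f)

edgesOf : ∀ {n} → Face n → List (Fin n)
edgesOf = map proj₁

record Complex : Set where
  field
    nV     : ℕ
    nE     : ℕ
    src    : Fin nE → Fin nV
    tgt    : Fin nE → Fin nV
    faces  : List (Face nE)
    faceOK : All (ClosedTrail src tgt) faces

open Complex

renTrav : ∀ {m n} → (Fin m → Fin n) → Trav m → Trav n
renTrav ι (x , b) = (ι x , b)

renFace : ∀ {m n} → (Fin m → Fin n) → Face m → Face n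
renFace ι = map (renTrav ι)

removeEdge : ∀ {n} → Fin n → Face n → Face n
removeEdge e [] = []
removeEdge e ((x , b) ∷ ts) with x ≟F e
... | yes _ = removeEdge e ts
... | no  _ = (x , b) ∷ removeEdge e ts

dropEmpty : ∀ {n} → List (Face n) → List (Face n)
dropEmpty []             = []
dropEmpty ([] ∷ fs)      = dropEmpty fs
dropEmpty ((t ∷ ts) ∷ fs) = (t ∷ ts) ∷ dropEmpty fs

opposite? : ∀ {n} → Trav n → Trav n → Bool
opposite? (x , b) (y , c) with x ≟F y | b ≟B not c
... | yes _ | yes _ = true
... | _     | _     = false

cancelLin : ∀ {n} → Face n → Face n
cancelLin (s ∷ t ∷ ts) = if opposite? s t then ts else s ∷ cancelLin (t ∷ ts)
cancelLin ts = ts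

lastT : ∀ {n} → Trav n → Face n → Trav n
lastT s []       = s
lastT s (t ∷ ts) = lastT t ts

initT : ∀ {n} → Trav n → Face n → Face n
initT s []       = []
initT s (t ∷ ts) = s ∷ initT t ts

cancelOnce : ∀ {n} → Face n → Face n
cancelOnce [] = []
cancelOnce (s ∷ []) = s ∷ []
cancelOnce (s ∷ t ∷ ts) =
  if opposite? (lastT t ts) s then initT t ts else cancelLin (s ∷ t ∷ ts)

-- repeatedly omit such pairs (length many rounds suffice)
reduceWith : ∀ {n} → ℕ → Face n → Face n
reduceWith zero    f = f
reduceWith (suc k) f = reduceWith k (cancelOnce f)

reduce : ∀ {n} → Face n → Face n
reduce f = reduceWith (length f) f

-- The five operations, as relations  Op C D  ("D is obtained from C").
-- New edges/vertices of D are related to old ones of C by explicit maps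
-- (so each step is determined up to relabelling).

module _ (C D : Complex) where
  private
    module C = Complex C
    module D = Complex D

  record ContractEdge : Set where
    field
      e        : Fin C.nE
      nonloop  : C.src e ≢ C.tgt e
      ι        : Fin D.nE → Fin C.nE
      ι-inj    : Injective _≡_ _≡_ ι
      ι-ne     : ∀ i → ι i ≢ e
      ι-onto   : ∀ x → x ≢ e → ∃ λ i → ι i ≡ x
      q        : Fin C.nV → Fin D.nV
      q-onto   : ∀ w → ∃ λ u → q u ≡ w
      q-ker    : ∀ u w → q u ≡ q w →
                 u ≡ w ⊎ ((u ≡ C.src e ⊎ u ≡ C.tgt e) × (w ≡ C.src e ⊎ w ≡ C.tgt e))
      q-end    : q (C.src e) ≡ q (C.tgt e)
      src-ok   : ∀ i → D.src i ≡ q (C.src (ι i))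
      tgt-ok   : ∀ i → D.tgt i ≡ q (C.tgt (ι i))
      faces-ok : map (renFace ι) D.faces ≡ map (removeEdge e) C.faces

module _ (C : Complex) (k : Fin (length (Complex.faces C))) where
  private
    module C = Complex C

  EdgeGone : Fin C.nE → Set
  EdgeGone x = x ∈ edgesOf (lookup C.faces k)
             × All (λ g → x ∉ edgesOf g) (removeAt C.faces k)

  VertexGone : Fin C.nV → Set
  VertexGone v = (∃ λ t → t ∈ lookup C.faces k × tailV C.src C.tgt t ≡ v)
               × (∀ x → (C.src x ≡ v ⊎ C.tgt x ≡ v) → EdgeGone x)

-- identify edge f with the parallel non-loop edge e (f traversed in the
-- direction matching e)
identify : ∀ {nV nE} → (Fin nE → Fin nV) → Fin nE → Fin nE → Trav nE → Trav nE
identify src f e (x , d) with x ≟F f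
... | no  _ = (x , d)
... | yes _ with src f ≟F src e
...   | yes _ = (e , d)
...   | no  _ = (e , not d)

-- end of an edge: (x , true) is the tgt end, (x , false) the src end
Dart : ℕ → Set
Dart n = Fin n × Bool

endV : ∀ {nV nE} → (Fin nE → Fin nV) → (Fin nE → Fin nV) → Dart nE → Fin nV
endV src tgt (x , b) = if b then tgt x else src x

headDart : ∀ {n} → Trav n → Dart n
headDart (x , b) = (x , b)

tailDart : ∀ {n} → Trav n → Dart n
tailDart (x , b) = (x , not b)

cycPairs : ∀ {n} → Face n → List (Trav n × Trav n)
cycPairs []       = []
cycPairs (t ∷ ts) = zip (t ∷ ts) (ts ∷ʳ t)

-- edges of the link graph L(v): a face traverses v between t and t′
LinkEdge : (C : Complex) → Fin (Complex.nV C) → Dart (Complex.nE C) → Dart (Complex.nE C) → Set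
LinkEdge C v d d′ =
  ∃ λ f → f ∈ Complex.faces C × ∃ λ t → ∃ λ t′ → (t , t′) ∈ cycPairs f
    × headV (Complex.src C) (Complex.tgt C) t ≡ v
    × d ≡ headDart t × d′ ≡ tailDart t′

LinkConn : (C : Complex) → Fin (Complex.nV C) → Dart (Complex.nE C) → Dart (Complex.nE C) → Set
LinkConn C v = Star (SymClosure (LinkEdge C v))

module _ (C D : Complex) where
  private
    module C = Complex C
    module D = Complex D

  record DeleteFace : Set where
    field
      k        : Fin (length C.faces)
      ι        : Fin D.nE → Fin C.nE
      ι-inj    : Injective _≡_ _≡_ ι
      ι-ok     : ∀ i → ¬ EdgeGone C k (ι i)
      ι-onto   : ∀ x → ¬ EdgeGone C k x → ∃ λ i → ι i ≡ x
      κ        : Fin D.nV → Fin C.nV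
      κ-inj    : Injective _≡_ _≡_ κ
      κ-ok     : ∀ w → ¬ VertexGone C k (κ w)
      κ-onto   : ∀ v → ¬ VertexGone C k v → ∃ λ w → κ w ≡ v
      src-ok   : ∀ i → κ (D.src i) ≡ C.src (ι i)
      tgt-ok   : ∀ i → κ (D.tgt i) ≡ C.tgt (ι i)
      faces-ok : map (renFace ι) D.faces ≡ removeAt C.faces k

  record ContractFace1 : Set where
    field
      k        : Fin (length C.faces)
      e        : Fin C.nE
      b        : Bool
      shape    : lookup C.faces k ≡ (e , b) ∷ []
      ι        : Fin D.nE → Fin C.nE
      ι-inj    : Injective _≡_ _≡_ ι
      ι-ne     : ∀ i → ι i ≢ e
      ι-onto   : ∀ x → x ≢ e → ∃ λ i → ι i ≡ x
      κ        : Fin D.nV → Fin C.nV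
      κ-bij    : Bij κ
      src-ok   : ∀ i → κ (D.src i) ≡ C.src (ι i)
      tgt-ok   : ∀ i → κ (D.tgt i) ≡ C.tgt (ι i)
      faces-ok : map (renFace ι) D.faces
                 ≡ dropEmpty (map (λ g → reduce (removeEdge e g)) (removeAt C.faces k))

  record ContractFace2 : Set where
    field
      k        : Fin (length C.faces)
      e        : Fin C.nE
      b        : Bool
      f        : Fin C.nE
      c        : Bool
      shape    : lookup C.faces k ≡ (e , b) ∷ (f , c) ∷ []
      e-nonloop : C.src e ≢ C.tgt e
      f-nonloop : C.src f ≢ C.tgt f
      ι        : Fin D.nE → Fin C.nE
      ι-inj    : Injective _≡_ _≡_ ι
      ι-ne     : ∀ i → ι i ≢ f
      ι-onto   : ∀ x → x ≢ f → ∃ λ i → ι i ≡ x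
      κ        : Fin D.nV → Fin C.nV
      κ-bij    : Bij κ
      src-ok   : ∀ i → κ (D.src i) ≡ C.src (ι i)
      tgt-ok   : ∀ i → κ (D.tgt i) ≡ C.tgt (ι i)
      faces-ok : map (renFace ι) D.faces
                 ≡ dropEmpty (map (λ g → reduce (map (identify C.src f e) g)) (removeAt C.faces k))

  record SplitVertex : Set where
    field
      v        : Fin C.nV
      ι        : Fin D.nE → Fin C.nE
      ι-bij    : Bij ι
      π        : Fin D.nV → Fin C.nV
      π-inj    : ∀ w w′ → π w ≡ π w′ → π w ≢ v → w ≡ w′
      π-onto   : ∀ u → u ≢ v → ∃ λ w → π w ≡ u
      src-ok   : ∀ i → π (D.src i) ≡ C.src (ι i)
      tgt-ok   : ∀ i → π (D.tgt i) ≡ C.tgt (ι i)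
      faces-ok : map (renFace ι) D.faces ≡ C.faces
      -- two ends at v go to the same copy iff they lie in the same
      -- component of L(v)
      same⇒conn : ∀ i b i′ b′ → endV C.src C.tgt (ι i , b) ≡ v → endV C.src C.tgt (ι i′ , b′) ≡ v →
                  endV D.src D.tgt (i , b) ≡ endV D.src D.tgt (i′ , b′) → LinkConn C v (ι i , b) (ι i′ , b′)
      conn⇒same : ∀ i b i′ b′ → endV C.src C.tgt (ι i , b) ≡ v → endV C.src C.tgt (ι i′ , b′) ≡ v →
                  LinkConn C v (ι i , b) (ι i′ , b′) → endV D.src D.tgt (i , b) ≡ endV D.src D.tgt (i′ , b′)
      -- every copy of v corresponds to a (nonempty) component
      copy-ok  : ∀ w → π w ≡ v → ∃ λ d → endV D.src D.tgt d ≡ w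

  record TopDelete : Set where
    field
      e        : Fin C.nE
      ι        : Fin D.nE → Fin C.nE
      ι-inj    : ∀ i j → ι i ≡ ι j → ι i ≢ e → i ≡ j
      ι-onto   : ∀ x → x ≢ e → ∃ λ i → ι i ≡ x
      κ        : Fin D.nV → Fin C.nV
      κ-bij    : Bij κ
      src-ok   : ∀ i → κ (D.src i) ≡ C.src (ι i)
      tgt-ok   : ∀ i → κ (D.tgt i) ≡ C.tgt (ι i)
      faces-ok : map (renFace ι) D.faces ≡ C.faces
      copy-ok  : ∀ i → ι i ≡ e → Σ (Fin (length D.faces)) λ j →
                   i ∈ edgesOf (lookup D.faces j)
                   × (∀ j′ → i ∈ edgesOf (lookup D.faces j′) → j′ ≡ j)

flipTrav : ∀ {n} → Trav n → Trav n
flipTrav (x , b) = (x , not b)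

rotate : ∀ {A : Set} → ℕ → List A → List A
rotate n xs = drop n xs ++ take n xs

SameFace : ∀ {n} → Face n → Face n → Set
SameFace g h = ∃ λ r → rotate r g ≡ h ⊎ rotate r (reverse (map flipTrav g)) ≡ h

module _ (C D : Complex) where
  private
    module C = Complex C
    module D = Complex D

  record Iso : Set where
    field
      σV       : Fin C.nV → Fin D.nV
      σV-bij   : Bij σV
      σE       : Fin C.nE → Fin D.nE
      σE-bij   : Bij σE
      fl       : Fin C.nE → Bool      -- whether the representation of edge x is reversed
      src-ok   : ∀ x → D.src (σE x) ≡ σV (if fl x then C.tgt x else C.src x)
      tgt-ok   : ∀ x → D.tgt (σE x) ≡ σV (if fl x then C.src x else C.tgt x)
      τ        : Fin (length C.faces) → Fin (length D.faces)
      τ-bij    : Bij τ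
      face-ok  : ∀ j → SameFace (map (λ t → (σE (proj₁ t) , (if fl (proj₁ t) then not (proj₂ t) else proj₂ t)))
                                     (lookup C.faces j))
                                (lookup D.faces (τ j))

data Step (C D : Complex) : Set where
  contractEdge  : ContractEdge C D → Step C D
  deleteFace    : DeleteFace C D → Step C D
  contractFace1 : ContractFace1 C D → Step C D
  contractFace2 : ContractFace2 C D → Step C D
  splitVertex   : SplitVertex C D → Step C D
  topDelete     : TopDelete C D → Step C D

_≼_ : Complex → Complex → Set
D ≼ C = ∃ λ C′ → Star Step C C′ × Iso C′ D

_≺_ : Complex → Complex → Set
D ≺ C = D ≼ C × ¬ (C ≼ D)

-- To a 2-complex attach the measure (total face length, number of free
-- edges, number of isolated vertices, slack), ordered lexicographically;
-- the slack is the gap between the number of edges and vertices and its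
-- bound 3 (free edges + face length) + isolated vertices. Contracting an
-- edge or a face and deleting a face shorten the faces or, for an edge on
-- no face, remove a free edge. Splitting a vertex and topologically
-- deleting an edge keep the faces; either they remove an isolated vertex
-- or a free edge, or they create several copies, which adds edges or
-- vertices, or a single copy, which merely relabels the complex.
-- Isomorphic complexes have equal measures, so a space minor of C either
-- has smaller measure or is isomorphic to C, and then C is a space minor
-- of it too. Strict space minors thus decrease a well-founded measure.

{-# OPTIONS --safe #-}
module Submission where

open import Defs
open import Level using (0ℓ)
open import Function using (_∘_)
open import Data.Bool using (Bool; true; false; not; if_then_else_)
open import Data.Bool.Properties using (not-involutive)
open import Data.Empty using (⊥)
open import Data.Product using (Σ; ∃; _×_; _,_; proj₁; proj₂)
open import Data.Product.Relation.Binary.Lex.Strict using (×-Lex; ×-transitive; ×-wellFounded)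
open import Data.Sum using (_⊎_; inj₁; inj₂)
open import Data.Nat using (ℕ; zero; suc; _+_; _*_; _∸_; _≤_; _<_; z≤n; s≤s)
open import Data.Nat.Properties
open import Data.Nat.Induction using (<-wellFounded)
open import Data.Nat.Solver using (module +-*-Solver)
open import Algebra.Properties.CommutativeSemigroup +-commutativeSemigroup using (xy∙z≈zy∙x; x∙yz≈y∙xz)
open import Algebra.Properties.CommutativeMonoid.Sum +-0-commutativeMonoid
  using (sum; sum-syntax; sum-cong-≗; sum-remove; sum-replicate-zero; ∑-distrib-+; ∑-comm; ∑-permute)
open import Data.Fin using (Fin; zero; suc; punchIn; punchOut; cast)
open import Data.Fin.Properties using (punchInᵢ≢i; punchIn-punchOut) renaming (_≟_ to _≟F_)
open import Data.Fin.Permutation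
  using (Permutation; permutation; _⟨$⟩ʳ_; _⟨$⟩ˡ_; _∘ₚ_; inverseˡ; inverseʳ; ↔⇒≡; flip; cast-id) renaming (id to idₚ)
open import Data.List using (List; []; _∷_; map; length; lookup; removeAt; concatMap; tabulate; _++_; reverse; take; drop)
open import Data.List.Properties
  using (length-++; length-map; length-tabulate; map-++; map-∘; map-cong; map-id; take-map; drop-map; take++drop≡id;
         reverse-map; reverse-++; reverse-involutive; ++-identityʳ)
open import Data.List.Membership.Propositional using (_∈_; _∉_; lose)
open import Data.List.Membership.Propositional.Properties
  using (∈-++⁺ˡ; ∈-++⁺ʳ; ∈-++⁻; ∈-concatMap⁺; ∈-concatMap⁻; ∈-map⁺; ∈-map⁻; ∈-tabulate⁺; ∈-tabulate⁻; ∈-lookup)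
open import Data.List.Relation.Unary.Any as Any using (Any; here; there; any?)
open import Data.List.Relation.Unary.Any.Properties using (lookup-index)
open import Data.List.Relation.Unary.All as All using ()
open import Data.List.Relation.Binary.Permutation.Propositional using (_↭_; ↭-sym; ↭-trans; ↭-reflexive)
open import Data.List.Relation.Binary.Permutation.Propositional.Properties
  using (++-comm; ↭-reverse; ↭-length; ∈-resp-↭; map⁺)
open import Induction.WellFounded using (WellFounded; Acc; acc)
open import Relation.Binary using (Rel; Transitive)
open import Relation.Binary.Construct.Closure.ReflexiveTransitive using (Star; ε; _◅_)
open import Relation.Binary.PropositionalEquality
open import Relation.Nullary using (¬_; Dec; yes; no; ¬?; contradiction)
open import Relation.Unary using (Pred; Decidable)

𝟙 : ∀ {p} {P : Set p} → Dec P → ℕ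
𝟙 (yes _) = 1
𝟙 (no _)  = 0

𝟙-yes : ∀ {p} {P : Set p} (P? : Dec P) → P → 𝟙 P? ≡ 1
𝟙-yes (yes _) _ = refl
𝟙-yes (no ¬p) p = contradiction p ¬p

𝟙-no : ∀ {p} {P : Set p} (P? : Dec P) → ¬ P → 𝟙 P? ≡ 0
𝟙-no (yes p) ¬p = contradiction p ¬p
𝟙-no (no _)  _  = refl

𝟙-cong : ∀ {p q} {P : Set p} {Q : Set q} (P? : Dec P) (Q? : Dec Q) → (P → Q) → (Q → P) → 𝟙 P? ≡ 𝟙 Q?
𝟙-cong (yes _) (yes _) _   _   = refl
𝟙-cong (yes p) (no ¬q) p→q _   = contradiction (p→q p) ¬q
𝟙-cong (no ¬p) (yes q) _   q→p = contradiction (q→p q) ¬p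
𝟙-cong (no _)  (no _)  _   _   = refl

𝟙-⊎ : ∀ {p q r} {P : Set p} {Q : Set q} {R : Set r} (P? : Dec P) (Q? : Dec Q) (R? : Dec R) →
      (R → P ⊎ Q) → 𝟙 R? ≤ 𝟙 P? + 𝟙 Q?
𝟙-⊎ _       _       (no _) _ = z≤n
𝟙-⊎ (yes _) _       (yes _) _ = s≤s z≤n
𝟙-⊎ (no _)  (yes _) (yes _) _ = s≤s z≤n
𝟙-⊎ (no ¬p) (no ¬q) (yes r) split with split r
... | inj₁ p = contradiction p ¬p
... | inj₂ q = contradiction q ¬q

𝟙-¬ : ∀ {p} {P : Set p} (P? : Dec P) → 𝟙 P? + 𝟙 (¬? P?) ≡ 1
𝟙-¬ (yes _) = refl
𝟙-¬ (no _)  = refl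

𝟙-¬-cong : ∀ {p q} {P : Set p} {Q : Set q} (P? : Dec P) (Q? : Dec Q) → (P → Q) → (Q → P) → 𝟙 (¬? P?) ≡ 𝟙 (¬? Q?)
𝟙-¬-cong P? Q? P→Q Q→P = 𝟙-cong (¬? P?) (¬? Q?) (λ ¬p → ¬p ∘ Q→P) (λ ¬q → ¬q ∘ P→Q)

𝟙-¬-holds : ∀ {p} {P : Set p} (P? : Dec P) → P → 𝟙 (¬? P?) ≡ 0
𝟙-¬-holds P? p = 𝟙-no (¬? P?) (λ ¬p → ¬p p)

+𝟙-¬-fails : ∀ {p} {P : Set p} (P? : Dec P) {a b} → a + 𝟙 (¬? P?) ≡ b → ¬ P → a < b
+𝟙-¬-fails P? {a} a+𝟙≡b ¬p =
  ≤-reflexive (trans (+-comm 1 a) (trans (cong (a +_) (sym (𝟙-yes (¬? P?) ¬p))) a+𝟙≡b))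

+𝟙-¬-holds : ∀ {p} {P : Set p} (P? : Dec P) {a b} → a + 𝟙 (¬? P?) ≡ b → P → a ≡ b
+𝟙-¬-holds P? {a} a+𝟙≡b p = trans (sym (+-identityʳ a)) (trans (cong (a +_) (sym (𝟙-¬-holds P? p))) a+𝟙≡b)

count : ∀ {n ℓ} {P : Pred (Fin n) ℓ} → Decidable P → ℕ
count {n} P? = ∑[ x < n ] 𝟙 (P? x)

∑-zero : ∀ {n} (f : Fin n → ℕ) → (∀ x → f x ≡ 0) → sum f ≡ 0
∑-zero {n} f f≗0 = trans (sum-cong-≗ f≗0) (sum-replicate-zero n)

∑-single : ∀ {n} (f : Fin n → ℕ) (j : Fin n) → (∀ x → x ≢ j → f x ≡ 0) → sum f ≡ f j
∑-single {suc n} f j off = begin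
  sum f                              ≡⟨ sum-remove f ⟩
  f j + sum (f ∘ punchIn j)          ≡⟨ cong (f j +_) (∑-zero _ (λ x → off _ (punchInᵢ≢i j x))) ⟩
  f j + 0                            ≡⟨ +-identityʳ _ ⟩
  f j                                ∎
  where open ≡-Reasoning

∑-≥ : ∀ {n} (f : Fin n → ℕ) (j : Fin n) → f j ≤ sum f
∑-≥ {suc n} f j = ≤-trans (m≤m+n (f j) _) (≤-reflexive (sym (sum-remove f)))

∑-one : ∀ n → ∑[ x < n ] 1 ≡ n
∑-one zero    = refl
∑-one (suc n) = cong suc (∑-one n)

∑-≥₂ : ∀ {n} (f : Fin n → ℕ) {i j} → i ≢ j → f i + f j ≤ sum f
∑-≥₂ {suc n} f {i} {j} i≢j = begin
  f i + f j                           ≡⟨ cong (λ k → f i + f k) (sym (punchIn-punchOut i≢j)) ⟩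
  f i + f (punchIn i (punchOut i≢j))  ≤⟨ +-monoʳ-≤ (f i) (∑-≥ (f ∘ punchIn i) _) ⟩
  f i + sum (f ∘ punchIn i)           ≡⟨ sum-remove f ⟨
  sum f                               ∎
  where open ≤-Reasoning

∑-mono-≤ : ∀ {n} {f g : Fin n → ℕ} → (∀ x → f x ≤ g x) → sum f ≤ sum g
∑-mono-≤ {zero}  f≤g = z≤n
∑-mono-≤ {suc n} f≤g = +-mono-≤ (f≤g zero) (∑-mono-≤ (f≤g ∘ suc))

count-complement : ∀ {n ℓ} {P : Pred (Fin n) ℓ} (P? : Decidable P) → count P? + count (¬? ∘ P?) ≡ n
count-complement {n} P? = begin
  count P? + count (¬? ∘ P?)             ≡⟨ ∑-distrib-+ (𝟙 ∘ P?) (𝟙 ∘ ¬? ∘ P?) ⟨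
  ∑[ x < n ] (𝟙 (P? x) + 𝟙 (¬? (P? x)))  ≡⟨ sum-cong-≗ (𝟙-¬ ∘ P?) ⟩
  ∑[ x < n ] 1                           ≡⟨ ∑-one n ⟩
  n                                      ∎
  where open ≡-Reasoning

∑-differAt : ∀ {n} (F Q : Fin n → ℕ) (p : Fin n) → (∀ x → x ≢ p → F x ≡ Q x) → sum F + Q p ≡ sum Q + F p
∑-differAt {suc n} F Q p agree = begin
  sum F + Q p                        ≡⟨ cong (_+ Q p) (sum-remove F) ⟩
  (F p + sum (F ∘ punchIn p)) + Q p  ≡⟨ cong (λ r → (F p + r) + Q p) (sum-cong-≗ (λ x → agree _ (punchInᵢ≢i p x))) ⟩
  (F p + sum (Q ∘ punchIn p)) + Q p  ≡⟨ xy∙z≈zy∙x (F p) _ (Q p) ⟩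
  (Q p + sum (Q ∘ punchIn p)) + F p  ≡⟨ cong (_+ F p) (sum-remove Q) ⟨
  sum Q + F p                        ∎
  where open ≡-Reasoning

-- Reindexing a sum along a map

fibreSum : ∀ {m n} → (Fin m → Fin n) → (Fin m → ℕ) → Fin n → ℕ
fibreSum {m} h G x = ∑[ j < m ] (𝟙 (h j ≟F x) * G j)

∑-fibres : ∀ {m n} (h : Fin m → Fin n) (G : Fin m → ℕ) → sum G ≡ ∑[ x < n ] fibreSum h G x
∑-fibres {m} {n} h G = begin
  sum G                                          ≡⟨ sum-cong-≗ (λ j → sym (inner j)) ⟩
  ∑[ j < m ] ∑[ x < n ] (𝟙 (h j ≟F x) * G j)     ≡⟨ ∑-comm (λ j x → 𝟙 (h j ≟F x) * G j) ⟩
  ∑[ x < n ] fibreSum h G x                      ∎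
  where
  open ≡-Reasoning
  inner : ∀ j → ∑[ x < n ] (𝟙 (h j ≟F x) * G j) ≡ G j
  inner j = begin
    ∑[ x < n ] (𝟙 (h j ≟F x) * G j)  ≡⟨ ∑-single _ (h j) (λ x x≢hj → cong (_* G j) (𝟙-no (h j ≟F x) (x≢hj ∘ sym))) ⟩
    𝟙 (h j ≟F h j) * G j            ≡⟨ cong (_* G j) (𝟙-yes (h j ≟F h j) refl) ⟩
    G j + 0                         ≡⟨ +-identityʳ (G j) ⟩
    G j                             ∎

fibreSum-single : ∀ {m n} (h : Fin m → Fin n) (G : Fin m → ℕ) {x j₀} →
                  h j₀ ≡ x → (∀ j → h j ≡ x → j ≡ j₀) → fibreSum h G x ≡ G j₀
fibreSum-single h G {x} {j₀} hj₀≡x unique = begin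
  fibreSum h G x          ≡⟨ ∑-single _ j₀ (λ j j≢j₀ → cong (_* G j) (𝟙-no (h j ≟F x) (j≢j₀ ∘ unique j))) ⟩
  𝟙 (h j₀ ≟F x) * G j₀    ≡⟨ cong (_* G j₀) (𝟙-yes (h j₀ ≟F x) hj₀≡x) ⟩
  G j₀ + 0                ≡⟨ +-identityʳ (G j₀) ⟩
  G j₀                    ∎
  where open ≡-Reasoning

Bij⇒Permutation : ∀ {m n} {h : Fin m → Fin n} → Bij h → Permutation m n
Bij⇒Permutation {h = h} (injective , surjective) =
  permutation h (proj₁ ∘ surjective) (proj₂ ∘ surjective) (λ x → injective (proj₂ (surjective (h x))))

Permutation⇒Bij : ∀ {m n} (π : Permutation m n) → Bij (π ⟨$⟩ʳ_)
Permutation⇒Bij π = (λ {i} {j} πi≡πj → trans (sym (inverseˡ π)) (trans (cong (π ⟨$⟩ˡ_) πi≡πj) (inverseˡ π)))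
                  , (λ y → π ⟨$⟩ˡ y , inverseʳ π)

∑-reindex : ∀ {m n} {h : Fin m → Fin n} → Bij h → (Q : Fin n → ℕ) → sum Q ≡ sum (Q ∘ h)
∑-reindex h-bij Q = ∑-permute Q (Bij⇒Permutation h-bij)

module BijectiveAway {m n} (h : Fin m → Fin n) (p : Fin n)
    (injective : ∀ i j → h i ≡ h j → h i ≢ p → i ≡ j)
    (surjective : ∀ x → x ≢ p → ∃ λ j → h j ≡ x) where

  ∑-reindexAway : (G : Fin m → ℕ) (Q : Fin n → ℕ) → (∀ j → h j ≢ p → G j ≡ Q (h j)) →
                  sum G + Q p ≡ sum Q + fibreSum h G p
  ∑-reindexAway G Q G≗Q∘h = trans (cong (_+ Q p) (∑-fibres h G)) (∑-differAt _ Q p agree)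
    where
    agree : ∀ x → x ≢ p → fibreSum h G x ≡ Q x
    agree x x≢p with surjective x x≢p
    ... | j , refl = trans (fibreSum-single h G refl (λ i hi≡hj → injective i j hi≡hj (x≢p ∘ trans (sym hi≡hj))))
                           (G≗Q∘h j x≢p)

  ∑-reindexAway-vanishing : (G : Fin m → ℕ) (Q : Fin n → ℕ) → (∀ j → h j ≢ p → G j ≡ Q (h j)) →
                            (∀ j → h j ≡ p → G j ≡ 0) → sum G + Q p ≡ sum Q
  ∑-reindexAway-vanishing G Q G≗Q∘h vanish =
    trans (∑-reindexAway G Q G≗Q∘h) (trans (cong (sum Q +_) (∑-zero _ term≡0)) (+-identityʳ _))
    where
    term≡0 : ∀ j → 𝟙 (h j ≟F p) * G j ≡ 0
    term≡0 j with h j ≟F p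
    ... | yes hj≡p = trans (+-identityʳ (G j)) (vanish j hj≡p)
    ... | no  _    = refl

  fibreSize : ℕ
  fibreSize = fibreSum h (λ _ → 1) p

  size : m + 1 ≡ n + fibreSize
  size = begin
    m + 1                     ≡⟨ cong (_+ 1) (∑-one m) ⟨
    ∑[ j < m ] 1 + 1          ≡⟨ ∑-reindexAway (λ _ → 1) (λ _ → 1) (λ _ _ → refl) ⟩
    ∑[ x < n ] 1 + fibreSize  ≡⟨ cong (_+ fibreSize) (∑-one n) ⟩
    n + fibreSize             ∎
    where open ≡-Reasoning

  bijective⊎growing : (∃ λ j → h j ≡ p) → Bij h ⊎ n < m
  bijective⊎growing (j₀ , hj₀≡p) with fibreSize ≤? 1
  ... | yes small = inj₁ (h-injective , h-surjective)
    where
    inFibre : ∀ {j} → h j ≡ p → 𝟙 (h j ≟F p) * 1 ≡ 1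
    inFibre {j} hj≡p = cong (_* 1) (𝟙-yes (h j ≟F p) hj≡p)

    fibre-unique : ∀ {i j} → h i ≡ p → h j ≡ p → i ≡ j
    fibre-unique {i} {j} hi≡p hj≡p with i ≟F j
    ... | yes i≡j = i≡j
    ... | no  i≢j = contradiction
      (≤-trans (≤-reflexive (cong₂ _+_ (sym (inFibre hi≡p)) (sym (inFibre hj≡p)))) (≤-trans (∑-≥₂ _ i≢j) small))
      (1+n≰n {1})

    h-injective : ∀ {i j} → h i ≡ h j → i ≡ j
    h-injective {i} {j} hi≡hj with h i ≟F p
    ... | yes hi≡p = fibre-unique hi≡p (trans (sym hi≡hj) hi≡p)
    ... | no  hi≢p = injective i j hi≡hj hi≢p

    h-surjective : ∀ x → ∃ λ j → h j ≡ x
    h-surjective x with x ≟F p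
    ... | yes refl = j₀ , hj₀≡p
    ... | no  x≢p  = surjective x x≢p
  ... | no large = inj₂ (+-cancelʳ-≤ 1 (suc n) m (begin
    suc n + 1      ≡⟨ +-suc n 1 ⟨
    n + 2          ≤⟨ +-monoʳ-≤ n (≰⇒> large) ⟩
    n + fibreSize  ≡⟨ size ⟨
    m + 1          ∎))
    where open ≤-Reasoning

_∈?_ : ∀ {n} (x : Fin n) (xs : List (Fin n)) → Dec (x ∈ xs)
x ∈? xs = any? (x ≟F_) xs

count-∈-≤ : ∀ {n} (xs : List (Fin n)) → count (_∈? xs) ≤ length xs
count-∈-≤ {n} []       = ≤-reflexive (∑-zero {n} _ (λ _ → refl))
count-∈-≤ {n} (y ∷ xs) = begin
  count (_∈? (y ∷ xs))                        ≤⟨ ∑-mono-≤ (λ x → 𝟙-⊎ (x ≟F y) (x ∈? xs) (x ∈? (y ∷ xs)) split) ⟩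
  ∑[ x < n ] (𝟙 (x ≟F y) + 𝟙 (x ∈? xs))       ≡⟨ ∑-distrib-+ (λ x → 𝟙 (x ≟F y)) (λ x → 𝟙 (x ∈? xs)) ⟩
  ∑[ x < n ] 𝟙 (x ≟F y) + count (_∈? xs)      ≡⟨ cong (_+ count (_∈? xs)) point ⟩
  1 + count (_∈? xs)                          ≤⟨ s≤s (count-∈-≤ xs) ⟩
  length (y ∷ xs)                             ∎
  where
  open ≤-Reasoning
  split : ∀ {x} → x ∈ y ∷ xs → x ≡ y ⊎ x ∈ xs
  split (here x≡y)   = inj₁ x≡y
  split (there x∈xs) = inj₂ x∈xs
  point : ∑[ x < n ] 𝟙 (x ≟F y) ≡ 1
  point = trans (∑-single _ y (λ x x≢y → 𝟙-no (x ≟F y) x≢y)) (𝟙-yes (y ≟F y) refl)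

∈-map⁻-injectiveAt : ∀ {a b} {A : Set a} {B : Set b} {f : A → B} {x xs} →
                     (∀ y → f y ≡ f x → y ≡ x) → f x ∈ map f xs → x ∈ xs
∈-map⁻-injectiveAt {f = f} injAt fx∈ with ∈-map⁻ f fx∈
... | y , y∈xs , fx≡fy = subst (_∈ _) (injAt y (sym fx≡fy)) y∈xs

allEdges : ∀ {n} → List (Face n) → List (Fin n)
allEdges = concatMap edgesOf

length-allEdges-∷ : ∀ {n} (f : Face n) fs → length (allEdges (f ∷ fs)) ≡ length f + length (allEdges fs)
length-allEdges-∷ f fs = trans (length-++ (edgesOf f)) (cong (_+ _) (length-map proj₁ f))

edgesOf-renFace : ∀ {m n} (ι : Fin m → Fin n) (f : Face m) → edgesOf (renFace ι f) ≡ map ι (edgesOf f)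
edgesOf-renFace ι []            = refl
edgesOf-renFace ι ((x , b) ∷ f) = cong (ι x ∷_) (edgesOf-renFace ι f)

allEdges-renFace : ∀ {m n} (ι : Fin m → Fin n) (fs : List (Face m)) →
                   allEdges (map (renFace ι) fs) ≡ map ι (allEdges fs)
allEdges-renFace ι []       = refl
allEdges-renFace ι (f ∷ fs) =
  trans (cong₂ _++_ (edgesOf-renFace ι f) (allEdges-renFace ι fs)) (sym (map-++ ι (edgesOf f) _))

length-allEdges-renFace : ∀ {m n} (ι : Fin m → Fin n) (fs : List (Face m)) →
                          length (allEdges (map (renFace ι) fs)) ≡ length (allEdges fs)
length-allEdges-renFace ι fs = trans (cong length (allEdges-renFace ι fs)) (length-map ι (allEdges fs))

∈-allEdges⁺ : ∀ {n} {x : Fin n} fs k → x ∈ edgesOf (lookup fs k) → x ∈ allEdges fs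
∈-allEdges⁺ fs k x∈ = ∈-concatMap⁺ edgesOf {xs = fs} (lose (∈-lookup {xs = fs} k) x∈)

∈-allEdges⁻ : ∀ {n} {x : Fin n} fs → x ∈ allEdges fs → ∃ λ k → x ∈ edgesOf (lookup fs k)
∈-allEdges⁻ fs x∈ = let x∈some = ∈-concatMap⁻ edgesOf {xs = fs} x∈ in Any.index x∈some , lookup-index x∈some

length-allEdges-removeAt : ∀ {n} (fs : List (Face n)) k →
                           length (allEdges fs) ≡ length (lookup fs k) + length (allEdges (removeAt fs k))
length-allEdges-removeAt (f ∷ fs) zero    = length-allEdges-∷ f fs
length-allEdges-removeAt (f ∷ fs) (suc k) = begin
  length (allEdges (f ∷ fs))                                      ≡⟨ length-allEdges-∷ f fs ⟩
  length f + length (allEdges fs)                                 ≡⟨ cong (length f +_) (length-allEdges-removeAt fs k) ⟩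
  length f + (length (lookup fs k) + length (allEdges fs∖k))      ≡⟨ x∙yz≈y∙xz (length f) (length (lookup fs k)) _ ⟩
  length (lookup fs k) + (length f + length (allEdges fs∖k))      ≡⟨ cong (length (lookup fs k) +_) (length-allEdges-∷ f fs∖k) ⟨
  length (lookup fs k) + length (allEdges (f ∷ fs∖k))             ∎
  where
  open ≡-Reasoning
  fs∖k = removeAt fs k

length-allEdges-dropEmpty : ∀ {n} (fs : List (Face n)) → length (allEdges (dropEmpty fs)) ≡ length (allEdges fs)
length-allEdges-dropEmpty []             = refl
length-allEdges-dropEmpty ([] ∷ fs)      = length-allEdges-dropEmpty fs
length-allEdges-dropEmpty ((t ∷ ts) ∷ fs) = begin
  length (allEdges ((t ∷ ts) ∷ dropEmpty fs))         ≡⟨ length-allEdges-∷ (t ∷ ts) (dropEmpty fs) ⟩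
  suc (length ts + length (allEdges (dropEmpty fs)))  ≡⟨ cong (λ l → suc (length ts + l)) (length-allEdges-dropEmpty fs) ⟩
  suc (length ts + length (allEdges fs))              ≡⟨ length-allEdges-∷ (t ∷ ts) fs ⟨
  length (allEdges ((t ∷ ts) ∷ fs))                   ∎
  where open ≡-Reasoning

module _ {n} (φ : Face n → Face n) (φ-≤ : ∀ f → length (φ f) ≤ length f) where

  length-allEdges-map-≤ : ∀ fs → length (allEdges (map φ fs)) ≤ length (allEdges fs)
  length-allEdges-map-≤ []       = z≤n
  length-allEdges-map-≤ (f ∷ fs) = begin
    length (allEdges (φ f ∷ map φ fs))          ≡⟨ length-allEdges-∷ (φ f) (map φ fs) ⟩
    length (φ f) + length (allEdges (map φ fs))  ≤⟨ +-mono-≤ (φ-≤ f) (length-allEdges-map-≤ fs) ⟩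
    length f + length (allEdges fs)              ≡⟨ length-allEdges-∷ f fs ⟨
    length (allEdges (f ∷ fs))                   ∎
    where open ≤-Reasoning

  length-allEdges-map-< : ∀ {fs} → Any (λ f → length (φ f) < length f) fs →
                          length (allEdges (map φ fs)) < length (allEdges fs)
  length-allEdges-map-< {f ∷ fs} shrinks = begin-strict
    length (allEdges (φ f ∷ map φ fs))          ≡⟨ length-allEdges-∷ (φ f) (map φ fs) ⟩
    length (φ f) + length (allEdges (map φ fs))  <⟨ step shrinks ⟩
    length f + length (allEdges fs)              ≡⟨ length-allEdges-∷ f fs ⟨
    length (allEdges (f ∷ fs))                   ∎
    where
    open ≤-Reasoning
    step : Any (λ f → length (φ f) < length f) (f ∷ fs) →
           length (φ f) + length (allEdges (map φ fs)) < length f + length (allEdges fs)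
    step (here φf<f)      = +-mono-<-≤ φf<f (length-allEdges-map-≤ fs)
    step (there shrinks′) = +-mono-≤-< (φ-≤ f) (length-allEdges-map-< shrinks′)

removeEdge-≤ : ∀ {n} (e : Fin n) f → length (removeEdge e f) ≤ length f
removeEdge-≤ e []             = z≤n
removeEdge-≤ e ((x , b) ∷ ts) with x ≟F e
... | yes _ = m≤n⇒m≤1+n (removeEdge-≤ e ts)
... | no  _ = s≤s (removeEdge-≤ e ts)

removeEdge-< : ∀ {n} (e : Fin n) f → e ∈ edgesOf f → length (removeEdge e f) < length f
removeEdge-< e ((x , b) ∷ ts) e∈f with x ≟F e | e∈f
... | yes _   | _           = s≤s (removeEdge-≤ e ts)
... | no  x≢e | here e≡x    = contradiction (sym e≡x) x≢e
... | no  _   | there e∈ts  = s≤s (removeEdge-< e ts e∈ts)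

removeEdge-fresh : ∀ {n} (e : Fin n) f → e ∉ edgesOf f → removeEdge e f ≡ f
removeEdge-fresh e []             _   = refl
removeEdge-fresh e ((x , b) ∷ ts) e∉f with x ≟F e
... | yes x≡e = contradiction (here (sym x≡e)) e∉f
... | no  _   = cong ((x , b) ∷_) (removeEdge-fresh e ts (e∉f ∘ there))

map-removeEdge-fresh : ∀ {n} (e : Fin n) fs → e ∉ allEdges fs → map (removeEdge e) fs ≡ fs
map-removeEdge-fresh e []       _   = refl
map-removeEdge-fresh e (f ∷ fs) e∉ =
  cong₂ _∷_ (removeEdge-fresh e f (e∉ ∘ ∈-++⁺ˡ)) (map-removeEdge-fresh e fs (e∉ ∘ ∈-++⁺ʳ (edgesOf f)))

cancelLin-≤ : ∀ {n} (f : Face n) → length (cancelLin f) ≤ length f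
cancelLin-≤ []           = z≤n
cancelLin-≤ (s ∷ [])     = ≤-refl
cancelLin-≤ (s ∷ t ∷ ts) = cancel (opposite? s t) (cancelLin-≤ (t ∷ ts))
  where
  cancel : ∀ b → length (cancelLin (t ∷ ts)) ≤ suc (length ts) →
           length (if b then ts else s ∷ cancelLin (t ∷ ts)) ≤ suc (suc (length ts))
  cancel true  _  = m≤n⇒m≤1+n (n≤1+n (length ts))
  cancel false ih = s≤s ih

length-initT : ∀ {n} (s : Trav n) ts → length (initT s ts) ≡ length ts
length-initT s []       = refl
length-initT s (t ∷ ts) = cong suc (length-initT t ts)

cancelOnce-≤ : ∀ {n} (f : Face n) → length (cancelOnce f) ≤ length f
cancelOnce-≤ []           = z≤n
cancelOnce-≤ (s ∷ [])     = ≤-refl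
cancelOnce-≤ (s ∷ t ∷ ts) = cancel (opposite? (lastT t ts) s)
  where
  cancel : ∀ b → length (if b then initT t ts else cancelLin (s ∷ t ∷ ts)) ≤ suc (suc (length ts))
  cancel true  = ≤-trans (≤-reflexive (length-initT t ts)) (m≤n⇒m≤1+n (n≤1+n (length ts)))
  cancel false = cancelLin-≤ (s ∷ t ∷ ts)

reduceWith-≤ : ∀ {n} k (f : Face n) → length (reduceWith k f) ≤ length f
reduceWith-≤ zero    f = ≤-refl
reduceWith-≤ (suc k) f = ≤-trans (reduceWith-≤ k (cancelOnce f)) (cancelOnce-≤ f)

reduce-≤ : ∀ {n} (f : Face n) → length (reduce f) ≤ length f
reduce-≤ f = reduceWith-≤ (length f) f

rotate-↭ : ∀ {A : Set} r (xs : List A) → rotate r xs ↭ xs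
rotate-↭ r xs = ↭-trans (++-comm (drop r xs) (take r xs)) (↭-reflexive (take++drop≡id r xs))

rotate-++ : ∀ {A : Set} (xs ys : List A) → rotate (length xs) (xs ++ ys) ≡ ys ++ xs
rotate-++ []       ys = refl
rotate-++ (x ∷ xs) ys = cong₂ _++_ (drop-prefix xs) (cong (x ∷_) (take-prefix xs))
  where
  drop-prefix : ∀ xs → drop (length xs) (xs ++ ys) ≡ ys
  drop-prefix []       = refl
  drop-prefix (_ ∷ xs) = drop-prefix xs
  take-prefix : ∀ xs → take (length xs) (xs ++ ys) ≡ xs
  take-prefix []       = refl
  take-prefix (x ∷ xs) = cong (x ∷_) (take-prefix xs)

rotate-map : ∀ {A B : Set} (f : A → B) r xs → map f (rotate r xs) ≡ rotate r (map f xs)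
rotate-map f r xs = trans (map-++ f (drop r xs) (take r xs)) (sym (cong₂ _++_ (drop-map r xs) (take-map r xs)))

reverseFace : ∀ {n} → Face n → Face n
reverseFace g = reverse (map flipTrav g)

reverseFace-++ : ∀ {n} (g h : Face n) → reverseFace (g ++ h) ≡ reverseFace h ++ reverseFace g
reverseFace-++ g h = trans (cong reverse (map-++ flipTrav g h)) (reverse-++ (map flipTrav g) (map flipTrav h))

reverseFace-involutive : ∀ {n} (g : Face n) → reverseFace (reverseFace g) ≡ g
reverseFace-involutive g = begin
  reverse (map flipTrav (reverse (map flipTrav g)))  ≡⟨ cong reverse (reverse-map flipTrav (map flipTrav g)) ⟩
  reverse (reverse (map flipTrav (map flipTrav g)))  ≡⟨ reverse-involutive _ ⟩
  map flipTrav (map flipTrav g)                       ≡⟨ map-∘ g ⟨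
  map (flipTrav ∘ flipTrav) g                         ≡⟨ map-cong (λ t → cong (proj₁ t ,_) (not-involutive (proj₂ t))) g ⟩
  map (λ t → t) g                                     ≡⟨ map-id g ⟩
  g                                                   ∎
  where open ≡-Reasoning

SameFace⇒edgesOf-↭ : ∀ {n} {g h : Face n} → SameFace g h → edgesOf g ↭ edgesOf h
SameFace⇒edgesOf-↭ {g = g} (r , inj₁ refl) = ↭-sym (map⁺ proj₁ (rotate-↭ r g))
SameFace⇒edgesOf-↭ {g = g} (r , inj₂ refl) = ↭-sym
  (↭-trans (map⁺ proj₁ (rotate-↭ r (reverseFace g)))
  (↭-trans (map⁺ proj₁ (↭-reverse (map flipTrav g)))
           (↭-reflexive (sym (map-∘ g)))))

SameFace-length : ∀ {n} {g h : Face n} → SameFace g h → length g ≡ length h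
SameFace-length {g = g} {h} g~h =
  trans (sym (length-map proj₁ g)) (trans (↭-length (SameFace⇒edgesOf-↭ g~h)) (length-map proj₁ h))

SameFace-sym : ∀ {n} {g h : Face n} → SameFace g h → SameFace h g
SameFace-sym {g = g} (r , inj₁ refl) =
  length (drop r g) , inj₁ (trans (rotate-++ (drop r g) (take r g)) (take++drop≡id r g))
SameFace-sym {g = g} (r , inj₂ refl) = s , inj₂ (begin
  rotate s (reverseFace (drop r g′ ++ take r g′))                 ≡⟨ cong (rotate s) (reverseFace-++ (drop r g′) (take r g′)) ⟩
  rotate s (reverseFace (take r g′) ++ reverseFace (drop r g′))   ≡⟨ rotate-++ (reverseFace (take r g′)) _ ⟩
  reverseFace (drop r g′) ++ reverseFace (take r g′)              ≡⟨ reverseFace-++ (take r g′) (drop r g′) ⟨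
  reverseFace (take r g′ ++ drop r g′)                            ≡⟨ cong reverseFace (take++drop≡id r g′) ⟩
  reverseFace g′                                                  ≡⟨ reverseFace-involutive g ⟩
  g                                                               ∎)
  where
  open ≡-Reasoning
  g′ = reverseFace g
  s = length (reverseFace (take r g′))

SameFace-map : ∀ {m n} (φ : Trav m → Trav n) → (∀ t → φ (flipTrav t) ≡ flipTrav (φ t)) →
               ∀ {g h} → SameFace g h → SameFace (map φ g) (map φ h)
SameFace-map φ φ-flip {g} (r , inj₁ refl) = r , inj₁ (sym (rotate-map φ r g))
SameFace-map φ φ-flip {g} (r , inj₂ refl) = r , inj₂ (begin
  rotate r (reverseFace (map φ g))             ≡⟨ cong (rotate r ∘ reverse) flip-φ ⟩
  rotate r (reverse (map φ (map flipTrav g)))  ≡⟨ cong (rotate r) (reverse-map φ (map flipTrav g)) ⟨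
  rotate r (map φ (reverseFace g))             ≡⟨ rotate-map φ r (reverseFace g) ⟨
  map φ (rotate r (reverseFace g))             ∎)
  where
  open ≡-Reasoning
  flip-φ : map flipTrav (map φ g) ≡ map φ (map flipTrav g)
  flip-φ = trans (sym (map-∘ g)) (trans (map-cong (sym ∘ φ-flip) g) (map-∘ g))

-- The measure

usedEdges : (C : Complex) → List (Fin (Complex.nE C))
usedEdges C = allEdges (Complex.faces C)

faceLength : Complex → ℕ
faceLength C = length (usedEdges C)

endpoints : (C : Complex) → List (Fin (Complex.nV C))
endpoints C = tabulate (Complex.src C) ++ tabulate (Complex.tgt C)

freeEdges : Complex → ℕ
freeEdges C = count (λ x → ¬? (x ∈? usedEdges C))

isolatedVertices : Complex → ℕ
isolatedVertices C = count (λ v → ¬? (v ∈? endpoints C))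

capacity : Complex → ℕ
capacity C = isolatedVertices C + 3 * (freeEdges C + faceLength C)

cellCount : Complex → ℕ
cellCount C = Complex.nE C + Complex.nV C

nE≤freeEdges+faceLength : ∀ C → Complex.nE C ≤ freeEdges C + faceLength C
nE≤freeEdges+faceLength C = begin
  nE                                        ≡⟨ count-complement (_∈? usedEdges C) ⟨
  count (_∈? usedEdges C) + freeEdges C     ≤⟨ +-monoˡ-≤ (freeEdges C) (count-∈-≤ (usedEdges C)) ⟩
  faceLength C + freeEdges C                ≡⟨ +-comm (faceLength C) (freeEdges C) ⟩
  freeEdges C + faceLength C                ∎
  where
  open ≤-Reasoning
  open Complex C

nV≤isolatedVertices+2nE : ∀ C → Complex.nV C ≤ isolatedVertices C + (Complex.nE C + Complex.nE C)
nV≤isolatedVertices+2nE C = begin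
  nV                                              ≡⟨ count-complement (_∈? endpoints C) ⟨
  count (_∈? endpoints C) + isolatedVertices C    ≤⟨ +-monoˡ-≤ (isolatedVertices C) (count-∈-≤ (endpoints C)) ⟩
  length (endpoints C) + isolatedVertices C       ≡⟨ cong (_+ isolatedVertices C) length-endpoints ⟩
  (nE + nE) + isolatedVertices C                  ≡⟨ +-comm (nE + nE) (isolatedVertices C) ⟩
  isolatedVertices C + (nE + nE)                  ∎
  where
  open ≤-Reasoning
  open Complex C
  length-endpoints : length (endpoints C) ≡ nE + nE
  length-endpoints = trans (length-++ (tabulate src)) (cong₂ _+_ (length-tabulate src) (length-tabulate tgt))

cellCount≤capacity : ∀ C → cellCount C ≤ capacity C
cellCount≤capacity C = begin
  nE + nV                      ≤⟨ +-monoʳ-≤ nE (nV≤isolatedVertices+2nE C) ⟩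
  nE + (i + (nE + nE))         ≤⟨ +-mono-≤ bound (+-monoʳ-≤ i (+-mono-≤ bound bound)) ⟩
  a + (i + (a + a))            ≡⟨ solve 2 (λ i a → a :+ (i :+ (a :+ a)) := i :+ con 3 :* a) refl i a ⟩
  i + 3 * a                    ∎
  where
  open ≤-Reasoning
  open Complex C
  open +-*-Solver
  i = isolatedVertices C
  a = freeEdges C + faceLength C
  bound = nE≤freeEdges+faceLength C

Measure : Set
Measure = ℕ × ℕ × ℕ × ℕ

_<ₗₑₓ_ : Rel Measure _
_<ₗₑₓ_ = ×-Lex _≡_ _<_ (×-Lex _≡_ _<_ (×-Lex _≡_ _<_ _<_))

<ₗₑₓ-trans : Transitive _<ₗₑₓ_
<ₗₑₓ-trans = lex (×-Lex _≡_ _<_ (×-Lex _≡_ _<_ _<_)) (lex (×-Lex _≡_ _<_ _<_) (lex _<_ <-trans))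
  where
  lex : ∀ {B : Set} (_<₂_ : Rel B 0ℓ) → Transitive _<₂_ → Transitive (×-Lex _≡_ _<_ _<₂_)
  lex _<₂_ = ×-transitive {_<₂_ = _<₂_} isEquivalence (resp₂ _<_) <-trans

<ₗₑₓ-wellFounded : WellFounded _<ₗₑₓ_
<ₗₑₓ-wellFounded =
  ×-wellFounded <-wellFounded (×-wellFounded <-wellFounded (×-wellFounded <-wellFounded <-wellFounded))

-- Once the first three components agree, capacity agrees too, so the last
-- one decreases exactly when cellCount grows (cellCount≤capacity).
measure : Complex → Measure
measure C = faceLength C , freeEdges C , isolatedVertices C , capacity C ∸ cellCount C

module LexDecrease (C D : Complex) where

  <ₗₑₓ-faceLength : faceLength D < faceLength C → measure D <ₗₑₓ measure C
  <ₗₑₓ-faceLength = inj₁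

  <ₗₑₓ-freeEdges : faceLength D ≡ faceLength C → freeEdges D < freeEdges C → measure D <ₗₑₓ measure C
  <ₗₑₓ-freeEdges T≡ f< = inj₂ (T≡ , inj₁ f<)

  <ₗₑₓ-isolatedVertices : faceLength D ≡ faceLength C → freeEdges D ≡ freeEdges C →
                          isolatedVertices D < isolatedVertices C → measure D <ₗₑₓ measure C
  <ₗₑₓ-isolatedVertices T≡ f≡ i< = inj₂ (T≡ , inj₂ (f≡ , inj₁ i<))

  <ₗₑₓ-cellCount : faceLength D ≡ faceLength C → freeEdges D ≡ freeEdges C →
                   isolatedVertices D ≡ isolatedVertices C → cellCount C < cellCount D → measure D <ₗₑₓ measure C
  <ₗₑₓ-cellCount T≡ f≡ i≡ grows = inj₂ (T≡ , inj₂ (f≡ , inj₂ (i≡ , slack<)))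
    where
    capacity≡ : capacity D ≡ capacity C
    capacity≡ = cong₂ (λ i a → i + 3 * a) i≡ (cong₂ _+_ f≡ T≡)
    slack< : capacity D ∸ cellCount D < capacity C ∸ cellCount C
    slack< = subst (λ c → capacity D ∸ cellCount D < c ∸ cellCount C) capacity≡
                   (∸-monoʳ-< grows (cellCount≤capacity D))

∈-endpoints⁺ : ∀ C d → endV (Complex.src C) (Complex.tgt C) d ∈ endpoints C
∈-endpoints⁺ C (x , true)  = ∈-++⁺ʳ (tabulate (Complex.src C)) (∈-tabulate⁺ x)
∈-endpoints⁺ C (x , false) = ∈-++⁺ˡ (∈-tabulate⁺ x)

∈-endpoints⁻ : ∀ C {v} → v ∈ endpoints C → ∃ λ d → endV (Complex.src C) (Complex.tgt C) d ≡ v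
∈-endpoints⁻ C v∈ with ∈-++⁻ (tabulate (Complex.src C)) v∈
... | inj₁ v∈src = let x , v≡ = ∈-tabulate⁻ v∈src in (x , false) , sym v≡
... | inj₂ v∈tgt = let x , v≡ = ∈-tabulate⁻ v∈tgt in (x , true) , sym v≡

renTrav-surjective : ∀ {m n} {ι : Fin m → Fin n} → (∀ x → ∃ λ i → ι i ≡ x) → ∀ d → ∃ λ d₀ → renTrav ι d₀ ≡ d
renTrav-surjective ι-surjective (x , b) = let i , ιi≡x = ι-surjective x in (i , b) , cong (_, b) ιi≡x

endV-renTrav : ∀ {C D : Complex} {κ : Fin (Complex.nV D) → Fin (Complex.nV C)}
                 {ι : Fin (Complex.nE D) → Fin (Complex.nE C)} →
               (∀ i → κ (Complex.src D i) ≡ Complex.src C (ι i)) →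
               (∀ i → κ (Complex.tgt D i) ≡ Complex.tgt C (ι i)) →
               ∀ d → κ (endV (Complex.src D) (Complex.tgt D) d) ≡ endV (Complex.src C) (Complex.tgt C) (renTrav ι d)
endV-renTrav src-ok tgt-ok (i , true)  = tgt-ok i
endV-renTrav src-ok tgt-ok (i , false) = src-ok i

module EndpointTransport (X Y : Complex)
    (κ : Fin (Complex.nV X) → Fin (Complex.nV Y)) (φ : Dart (Complex.nE X) → Dart (Complex.nE Y))
    (κ-endV : ∀ d → κ (endV (Complex.src X) (Complex.tgt X) d) ≡ endV (Complex.src Y) (Complex.tgt Y) (φ d))
    (φ-surjective : ∀ d → ∃ λ d₀ → φ d₀ ≡ d) where

  endpoint-lift : ∀ {u} → u ∈ endpoints Y → ∃ λ w → w ∈ endpoints X × κ w ≡ u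
  endpoint-lift u∈ with ∈-endpoints⁻ Y u∈
  ... | d , refl with φ-surjective d
  ... | d₀ , refl = _ , ∈-endpoints⁺ X d₀ , κ-endV d₀

  isolated-𝟙 : ∀ w → (∀ w′ → κ w′ ≡ κ w → w′ ≡ w) →
               𝟙 (¬? (w ∈? endpoints X)) ≡ 𝟙 (¬? (κ w ∈? endpoints Y))
  isolated-𝟙 w injAt = 𝟙-¬-cong (w ∈? endpoints X) (κ w ∈? endpoints Y) forth back
    where
    forth : w ∈ endpoints X → κ w ∈ endpoints Y
    forth w∈ with ∈-endpoints⁻ X w∈
    ... | d , refl = subst (_∈ endpoints Y) (sym (κ-endV d)) (∈-endpoints⁺ Y (φ d))
    back : κ w ∈ endpoints Y → w ∈ endpoints X
    back κw∈ = let w′ , w′∈ , κw′≡κw = endpoint-lift κw∈ in subst (_∈ endpoints X) (injAt w′ κw′≡κw) w′∈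

  isolatedVertices≡ : Bij κ → isolatedVertices X ≡ isolatedVertices Y
  isolatedVertices≡ κ-bij =
    trans (sum-cong-≗ (λ w → isolated-𝟙 w (λ _ → proj₁ κ-bij))) (sym (∑-reindex κ-bij _))

module RenamedFaces (C D : Complex) (ι : Fin (Complex.nE D) → Fin (Complex.nE C))
    (faces≡ : map (renFace ι) (Complex.faces D) ≡ Complex.faces C) where

  usedEdges≡ : usedEdges C ≡ map ι (usedEdges D)
  usedEdges≡ = trans (cong allEdges (sym faces≡)) (allEdges-renFace ι (Complex.faces D))

  faceLength≡ : faceLength D ≡ faceLength C
  faceLength≡ = trans (sym (length-map ι (usedEdges D))) (cong length (sym usedEdges≡))

  free-𝟙 : ∀ j → (∀ i → ι i ≡ ι j → i ≡ j) → 𝟙 (¬? (j ∈? usedEdges D)) ≡ 𝟙 (¬? (ι j ∈? usedEdges C))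
  free-𝟙 j injAt = 𝟙-¬-cong (j ∈? usedEdges D) (ι j ∈? usedEdges C)
    (λ j∈ → subst (ι j ∈_) (sym usedEdges≡) (∈-map⁺ ι j∈))
    (λ ιj∈ → ∈-map⁻-injectiveAt injAt (subst (ι j ∈_) usedEdges≡ ιj∈))

  freeEdges≡ : Bij ι → freeEdges D ≡ freeEdges C
  freeEdges≡ ι-bij = trans (sum-cong-≗ (λ j → free-𝟙 j (λ _ → proj₁ ι-bij))) (sym (∑-reindex ι-bij _))

-- The operations

record Relabelling (D C : Complex) : Set where
  private
    module C = Complex C
    module D = Complex D
  field
    vertex     : Fin D.nV → Fin C.nV
    vertex-bij : Bij vertex
    edge       : Fin D.nE → Fin C.nE
    edge-bij   : Bij edge
    src-ok     : ∀ x → C.src (edge x) ≡ vertex (D.src x)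
    tgt-ok     : ∀ x → C.tgt (edge x) ≡ vertex (D.tgt x)
    faces-ok   : map (renFace edge) D.faces ≡ C.faces

module _ {C D : Complex} where
  private
    module C = Complex C
    module D = Complex D

  cellCount-<-nV : C.nE ≡ D.nE → C.nV < D.nV → cellCount C < cellCount D
  cellCount-<-nV nE≡ nV< = subst (λ n → cellCount C < n + D.nV) nE≡ (+-monoʳ-< C.nE nV<)

  cellCount-<-nE : C.nE < D.nE → C.nV ≡ D.nV → cellCount C < cellCount D
  cellCount-<-nE nE< nV≡ = subst (λ n → cellCount C < D.nE + n) nV≡ (+-monoˡ-< C.nV nE<)

faceLength-renFace : ∀ (D : Complex) {n} {ι : Fin (Complex.nE D) → Fin n} {fs} →
                     map (renFace ι) (Complex.faces D) ≡ fs → faceLength D ≡ length (allEdges fs)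
faceLength-renFace D {ι = ι} faces≡ =
  trans (sym (length-allEdges-renFace ι (Complex.faces D))) (cong (length ∘ allEdges) faces≡)

closedTrail-nonempty : ∀ {nV nE} {src tgt : Fin nE → Fin nV} {f} → ClosedTrail src tgt f → 0 < length f
closedTrail-nonempty {f = []}    (() , _)
closedTrail-nonempty {f = _ ∷ _} _ = s≤s z≤n

faceLength-removeAt : ∀ C k → length (allEdges (removeAt (Complex.faces C) k)) < faceLength C
faceLength-removeAt C k = begin-strict
  length (allEdges (removeAt faces k))                          <⟨ m<n+m _ (closedTrail-nonempty (All.lookup faceOK (∈-lookup k))) ⟩
  length (lookup faces k) + length (allEdges (removeAt faces k)) ≡⟨ length-allEdges-removeAt faces k ⟨
  faceLength C                                                  ∎
  where
  open ≤-Reasoning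
  open Complex C

module _ {C D : Complex} (r : ContractEdge C D) where
  private
    module C = Complex C
    module D = Complex D
  open ContractEdge r
  open LexDecrease C D

  contractEdge-decreases : measure D <ₗₑₓ measure C
  contractEdge-decreases with e ∈? usedEdges C
  ... | yes e-used = <ₗₑₓ-faceLength (begin-strict
    faceLength D                                    ≡⟨ faceLength-renFace D faces-ok ⟩
    length (allEdges (map (removeEdge e) C.faces))  <⟨ length-allEdges-map-< (removeEdge e) (removeEdge-≤ e) e-shortens ⟩
    faceLength C                                    ∎)
    where
    open ≤-Reasoning
    e-shortens : Any (λ f → length (removeEdge e f) < length f) C.faces
    e-shortens = Any.map (removeEdge-< e _) (∈-concatMap⁻ edgesOf {xs = C.faces} e-used)
  ... | no e-free = <ₗₑₓ-freeEdges faceLength≡ (+𝟙-¬-fails (e ∈? usedEdges C) freeCount e-free)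
    where
    open RenamedFaces C D ι (trans faces-ok (map-removeEdge-fresh e C.faces e-free))
    open BijectiveAway ι e (λ i j ιi≡ιj _ → ι-inj ιi≡ιj) ι-onto
    freeCount : freeEdges D + 𝟙 (¬? (e ∈? usedEdges C)) ≡ freeEdges C
    freeCount = ∑-reindexAway-vanishing _ _ (λ j _ → free-𝟙 j (λ _ → ι-inj))
                                            (λ j ιj≡e → contradiction ιj≡e (ι-ne j))

deleteFace-decreases : ∀ {C D} → DeleteFace C D → measure D <ₗₑₓ measure C
deleteFace-decreases {C} {D} r = LexDecrease.<ₗₑₓ-faceLength C D
  (subst (_< faceLength C) (sym (faceLength-renFace D faces-ok)) (faceLength-removeAt C k))
  where open DeleteFace r

contractFace-decreases : ∀ {C D} (ψ : Face (Complex.nE C) → Face (Complex.nE C)) → (∀ f → length (ψ f) ≤ length f) →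
                         ∀ k {ι : Fin (Complex.nE D) → Fin (Complex.nE C)} →
                         map (renFace ι) (Complex.faces D)
                           ≡ dropEmpty (map (λ g → reduce (ψ g)) (removeAt (Complex.faces C) k)) →
                         measure D <ₗₑₓ measure C
contractFace-decreases {C} {D} ψ ψ-≤ k faces-ok = LexDecrease.<ₗₑₓ-faceLength C D (begin-strict
  faceLength D                                         ≡⟨ faceLength-renFace D faces-ok ⟩
  length (allEdges (dropEmpty (map (reduce ∘ ψ) C∖k)))  ≡⟨ length-allEdges-dropEmpty (map (reduce ∘ ψ) C∖k) ⟩
  length (allEdges (map (reduce ∘ ψ) C∖k))              ≤⟨ length-allEdges-map-≤ (reduce ∘ ψ) reduce∘ψ-≤ C∖k ⟩
  length (allEdges C∖k)                                 <⟨ faceLength-removeAt C k ⟩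
  faceLength C                                          ∎)
  where
  open ≤-Reasoning
  C∖k = removeAt (Complex.faces C) k
  reduce∘ψ-≤ : ∀ f → length (reduce (ψ f)) ≤ length f
  reduce∘ψ-≤ f = ≤-trans (reduce-≤ (ψ f)) (ψ-≤ f)

contractFace1-decreases : ∀ {C D} → ContractFace1 C D → measure D <ₗₑₓ measure C
contractFace1-decreases {C} {D} r = contractFace-decreases {C} {D} (removeEdge e) (removeEdge-≤ e) k faces-ok
  where open ContractFace1 r

contractFace2-decreases : ∀ {C D} → ContractFace2 C D → measure D <ₗₑₓ measure C
contractFace2-decreases {C} {D} r =
  contractFace-decreases {C} {D} (map (identify (Complex.src C) f e)) (λ g → ≤-reflexive (length-map _ g)) k faces-ok
  where open ContractFace2 r

module _ {C D : Complex} (r : SplitVertex C D) where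
  private
    module C = Complex C
    module D = Complex D
  open SplitVertex r
  open LexDecrease C D
  open RenamedFaces C D ι faces-ok
  open EndpointTransport D C π (renTrav ι) (endV-renTrav {C} {D} {π} src-ok tgt-ok) (renTrav-surjective (proj₂ ι-bij))
  open BijectiveAway π v π-inj π-onto

  private
    isolatedCount : isolatedVertices D + 𝟙 (¬? (v ∈? endpoints C)) ≡ isolatedVertices C
    isolatedCount = ∑-reindexAway-vanishing _ _
      (λ w πw≢v → isolated-𝟙 w (λ w′ πw′≡πw → π-inj w′ w πw′≡πw (πw≢v ∘ trans (sym πw′≡πw))))
      (λ w πw≡v → let d , endd≡w = copy-ok w πw≡v in
                  𝟙-¬-holds (w ∈? endpoints D) (subst (_∈ endpoints D) endd≡w (∈-endpoints⁺ D d)))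

    relabelling : Bij π → Relabelling D C
    relabelling π-bij = record
      { vertex = π ; vertex-bij = π-bij ; edge = ι ; edge-bij = ι-bij
      ; src-ok = sym ∘ src-ok ; tgt-ok = sym ∘ tgt-ok ; faces-ok = faces-ok }

  splitVertex-decreases-or-relabels : measure D <ₗₑₓ measure C ⊎ Relabelling D C
  splitVertex-decreases-or-relabels with v ∈? endpoints C
  ... | no v-isolated = inj₁ (<ₗₑₓ-isolatedVertices faceLength≡ (freeEdges≡ ι-bij)
                                 (+𝟙-¬-fails (v ∈? endpoints C) isolatedCount v-isolated))
  ... | yes v-incident with bijective⊎growing (let w , _ , πw≡v = endpoint-lift v-incident in w , πw≡v)
  ...   | inj₁ π-bij = inj₂ (relabelling π-bij)
  ...   | inj₂ nV<   = inj₁ (<ₗₑₓ-cellCount faceLength≡ (freeEdges≡ ι-bij)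
                               (+𝟙-¬-holds (v ∈? endpoints C) isolatedCount v-incident)
                               (cellCount-<-nV {C} {D} (sym (↔⇒≡ (Bij⇒Permutation ι-bij))) nV<))

module _ {C D : Complex} (r : TopDelete C D) where
  private
    module C = Complex C
    module D = Complex D
  open TopDelete r
  open LexDecrease C D
  open RenamedFaces C D ι faces-ok
  open BijectiveAway ι e ι-inj ι-onto

  private
    freeCount : freeEdges D + 𝟙 (¬? (e ∈? usedEdges C)) ≡ freeEdges C
    freeCount = ∑-reindexAway-vanishing _ _
      (λ j ιj≢e → free-𝟙 j (λ i ιi≡ιj → ι-inj i j ιi≡ιj (ιj≢e ∘ trans (sym ιi≡ιj))))
      (λ j ιj≡e → let k , j∈k , _ = copy-ok j ιj≡e in
                  𝟙-¬-holds (j ∈? usedEdges D) (∈-allEdges⁺ D.faces k j∈k))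

    module Used (e-used : e ∈ usedEdges C) where
      copy : ∃ λ j → ι j ≡ e
      copy = let j , _ , e≡ιj = ∈-map⁻ ι (subst (e ∈_) usedEdges≡ e-used) in j , sym e≡ιj

      ι-surjective : ∀ x → ∃ λ j → ι j ≡ x
      ι-surjective x with x ≟F e
      ... | yes refl = copy
      ... | no  x≢e  = ι-onto x x≢e

      open EndpointTransport D C κ (renTrav ι) (endV-renTrav {C} {D} {κ} src-ok tgt-ok) (renTrav-surjective ι-surjective)
        public using (isolatedVertices≡)

    relabelling : Bij ι → Relabelling D C
    relabelling ι-bij = record
      { vertex = κ ; vertex-bij = κ-bij ; edge = ι ; edge-bij = ι-bij
      ; src-ok = sym ∘ src-ok ; tgt-ok = sym ∘ tgt-ok ; faces-ok = faces-ok }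

  topDelete-decreases-or-relabels : measure D <ₗₑₓ measure C ⊎ Relabelling D C
  topDelete-decreases-or-relabels with e ∈? usedEdges C
  ... | no e-free = inj₁ (<ₗₑₓ-freeEdges faceLength≡ (+𝟙-¬-fails (e ∈? usedEdges C) freeCount e-free))
  ... | yes e-used with bijective⊎growing (Used.copy e-used)
  ...   | inj₁ ι-bij = inj₂ (relabelling ι-bij)
  ...   | inj₂ nE<   = inj₁ (<ₗₑₓ-cellCount faceLength≡ (+𝟙-¬-holds (e ∈? usedEdges C) freeCount e-used)
                               (Used.isolatedVertices≡ e-used κ-bij)
                               (cellCount-<-nE {C} {D} nE< (sym (↔⇒≡ (Bij⇒Permutation κ-bij)))))

-- Isomorphisms

isoTrav : ∀ {m n} → (Fin m → Fin n) → (Fin m → Bool) → Trav m → Trav n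
isoTrav σ fl t = (σ (proj₁ t) , (if fl (proj₁ t) then not (proj₂ t) else proj₂ t))

isoTrav-flip : ∀ {m n} (σ : Fin m → Fin n) fl t → isoTrav σ fl (flipTrav t) ≡ flipTrav (isoTrav σ fl t)
isoTrav-flip σ fl (x , b) with fl x
... | true  = refl
... | false = refl

isoTrav-inverse : ∀ {m n} {σ : Fin m → Fin n} {σ⁻ : Fin n → Fin m} (fl : Fin m → Bool) →
                  (∀ x → σ⁻ (σ x) ≡ x) → ∀ t → isoTrav σ⁻ (fl ∘ σ⁻) (isoTrav σ fl t) ≡ t
isoTrav-inverse fl σ⁻σ (x , b) rewrite σ⁻σ x with fl x
... | true  = cong (x ,_) (not-involutive b)
... | false = refl

edgesOf-isoTrav : ∀ {m n} (σ : Fin m → Fin n) fl (g : Face m) → edgesOf (map (isoTrav σ fl) g) ≡ map σ (edgesOf g)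
edgesOf-isoTrav σ fl g = trans (sym (map-∘ g)) (map-∘ g)

length-allEdges≡∑ : ∀ {n} (fs : List (Face n)) → length (allEdges fs) ≡ ∑[ k < length fs ] length (lookup fs k)
length-allEdges≡∑ []       = refl
length-allEdges≡∑ (f ∷ fs) = trans (length-allEdges-∷ f fs) (cong (length f +_) (length-allEdges≡∑ fs))

module _ {C D : Complex} (I : Iso C D) where
  private
    module C = Complex C
    module D = Complex D
  open Iso I

  private
    σE-injective = proj₁ σE-bij

    face-edges : ∀ k → edgesOf (lookup D.faces (τ k)) ↭ map σE (edgesOf (lookup C.faces k))
    face-edges k = ↭-trans (↭-sym (SameFace⇒edgesOf-↭ (face-ok k))) (↭-reflexive (edgesOf-isoTrav σE fl _))

    used-forth : ∀ {x} → x ∈ usedEdges C → σE x ∈ usedEdges D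
    used-forth x∈ = let k , x∈k = ∈-allEdges⁻ C.faces x∈ in
      ∈-allEdges⁺ D.faces (τ k) (∈-resp-↭ (↭-sym (face-edges k)) (∈-map⁺ σE x∈k))

    used-back : ∀ {x} → σE x ∈ usedEdges D → x ∈ usedEdges C
    used-back σx∈ with ∈-allEdges⁻ D.faces σx∈
    ... | k′ , σx∈k′ with proj₂ τ-bij k′
    ... | k , refl = ∈-allEdges⁺ C.faces k (∈-map⁻-injectiveAt (λ _ → σE-injective) (∈-resp-↭ (face-edges k) σx∈k′))

    σV-endV : ∀ d → σV (endV C.src C.tgt d) ≡ endV D.src D.tgt (isoTrav σE fl d)
    σV-endV (x , b) with fl x | src-ok x | tgt-ok x
    σV-endV (x , true)  | true  | s | _ = sym s
    σV-endV (x , false) | true  | _ | t = sym t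
    σV-endV (x , true)  | false | _ | t = sym t
    σV-endV (x , false) | false | s | _ = sym s

    isoTrav-surjective : ∀ d → ∃ λ d₀ → isoTrav σE fl d₀ ≡ d
    isoTrav-surjective (y , b) with proj₂ σE-bij y
    ... | x , refl = (x , (if fl x then not b else b)) , cong (σE x ,_) (unflip (fl x))
      where
      unflip : ∀ c → (if c then not (if c then not b else b) else (if c then not b else b)) ≡ b
      unflip true  = not-involutive b
      unflip false = refl

    faceLength≡ : faceLength C ≡ faceLength D
    faceLength≡ = begin
      faceLength C                                          ≡⟨ length-allEdges≡∑ C.faces ⟩
      ∑[ k < length C.faces ] length (lookup C.faces k)      ≡⟨ sum-cong-≗ face-length ⟩
      ∑[ k < length C.faces ] length (lookup D.faces (τ k))  ≡⟨ ∑-reindex τ-bij _ ⟨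
      ∑[ k < length D.faces ] length (lookup D.faces k)      ≡⟨ length-allEdges≡∑ D.faces ⟨
      faceLength D                                          ∎
      where
      open ≡-Reasoning
      face-length : ∀ k → length (lookup C.faces k) ≡ length (lookup D.faces (τ k))
      face-length k = trans (sym (length-map (isoTrav σE fl) (lookup C.faces k))) (SameFace-length (face-ok k))

    freeEdges≡ : freeEdges C ≡ freeEdges D
    freeEdges≡ = trans (sum-cong-≗ (λ x → 𝟙-¬-cong (x ∈? usedEdges C) (σE x ∈? usedEdges D) used-forth used-back))
                       (sym (∑-reindex σE-bij _))

    isolatedVertices≡ : isolatedVertices C ≡ isolatedVertices D
    isolatedVertices≡ = EndpointTransport.isolatedVertices≡ C D σV (isoTrav σE fl) σV-endV isoTrav-surjective σV-bij

    cellCount≡ : cellCount C ≡ cellCount D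
    cellCount≡ = cong₂ _+_ (↔⇒≡ (Bij⇒Permutation σE-bij)) (↔⇒≡ (Bij⇒Permutation σV-bij))

  measure-Iso : measure C ≡ measure D
  measure-Iso = cong₂ _,_ faceLength≡ (cong₂ _,_ freeEdges≡ (cong₂ _,_ isolatedVertices≡
                  (cong₂ _∸_ (cong₂ (λ i a → i + 3 * a) isolatedVertices≡ (cong₂ _+_ freeEdges≡ faceLength≡)) cellCount≡)))

Iso-sym : ∀ {C D} → Iso C D → Iso D C
Iso-sym {C} {D} I = record
  { σV = πV ⟨$⟩ˡ_ ; σV-bij = Permutation⇒Bij (flip πV)
  ; σE = σE⁻ ; σE-bij = Permutation⇒Bij (flip πE)
  ; fl = fl ∘ σE⁻
  ; src-ok = src-ok⁻ ; tgt-ok = tgt-ok⁻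
  ; τ = πF ⟨$⟩ˡ_ ; τ-bij = Permutation⇒Bij (flip πF)
  ; face-ok = face-ok⁻ }
  where
  module C = Complex C
  module D = Complex D
  open Iso I
  πV = Bij⇒Permutation σV-bij
  πE = Bij⇒Permutation σE-bij
  πF = Bij⇒Permutation τ-bij

  σE⁻ : Fin D.nE → Fin C.nE
  σE⁻ = πE ⟨$⟩ˡ_

  recover : ∀ (end : Fin D.nE → Fin D.nV) y {u} → end (σE (σE⁻ y)) ≡ σV u → u ≡ πV ⟨$⟩ˡ end y
  recover end y e = trans (sym (inverseˡ πV)) (cong (πV ⟨$⟩ˡ_) (trans (sym e) (cong end (inverseʳ πE))))

  src-ok⁻ : ∀ y → C.src (σE⁻ y) ≡ πV ⟨$⟩ˡ (if fl (σE⁻ y) then D.tgt y else D.src y)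
  src-ok⁻ y with fl (σE⁻ y) | src-ok (σE⁻ y) | tgt-ok (σE⁻ y)
  ... | false | s | _ = recover D.src y s
  ... | true  | _ | t = recover D.tgt y t

  tgt-ok⁻ : ∀ y → C.tgt (σE⁻ y) ≡ πV ⟨$⟩ˡ (if fl (σE⁻ y) then D.src y else D.tgt y)
  tgt-ok⁻ y with fl (σE⁻ y) | src-ok (σE⁻ y) | tgt-ok (σE⁻ y)
  ... | false | _ | t = recover D.tgt y t
  ... | true  | s | _ = recover D.src y s

  face-ok⁻ : ∀ j → SameFace (map (isoTrav σE⁻ (fl ∘ σE⁻)) (lookup D.faces j)) (lookup C.faces (πF ⟨$⟩ˡ j))
  face-ok⁻ j = subst (SameFace (map ψ (lookup D.faces j))) ψ∘φ≡id
                     (SameFace-map ψ (isoTrav-flip σE⁻ (fl ∘ σE⁻)) (SameFace-sym face-ok-j))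
    where
    ψ = isoTrav σE⁻ (fl ∘ σE⁻)
    g = lookup C.faces (πF ⟨$⟩ˡ j)
    ψ∘φ≡id : map ψ (map (isoTrav σE fl) g) ≡ g
    ψ∘φ≡id = trans (sym (map-∘ g))
             (trans (map-cong (isoTrav-inverse {σ = σE} {σ⁻ = σE⁻} fl (λ _ → inverseˡ πE)) g) (map-id g))
    face-ok-j : SameFace (map (isoTrav σE fl) g) (lookup D.faces j)
    face-ok-j = subst (λ k → SameFace (map (isoTrav σE fl) g) (lookup D.faces k)) (inverseʳ πF) (face-ok (πF ⟨$⟩ˡ j))

lookup-map≡ : ∀ {A B : Set} (f : A → B) xs {ys} → map f xs ≡ ys →
              Σ (Permutation (length xs) (length ys)) λ π → ∀ k → lookup ys (π ⟨$⟩ʳ k) ≡ f (lookup xs k)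
lookup-map≡ f xs refl = cast-id (sym (length-map f xs)) , lookup-map-cast xs {sym (length-map f xs)}
  where
  lookup-map-cast : ∀ xs .{eq : length xs ≡ length (map f xs)} k → lookup (map f xs) (cast eq k) ≡ f (lookup xs k)
  lookup-map-cast (x ∷ xs) zero    = refl
  lookup-map-cast (x ∷ xs) (suc k) = lookup-map-cast xs {sym (length-map f xs)} k

Iso-relabel : ∀ {X D C} → Iso X D → Relabelling D C → Iso X C
Iso-relabel {X} {D} {C} I R = record
  { σV = R.vertex ∘ I.σV ; σV-bij = Permutation⇒Bij (Bij⇒Permutation I.σV-bij ∘ₚ Bij⇒Permutation R.vertex-bij)
  ; σE = R.edge ∘ I.σE ; σE-bij = Permutation⇒Bij (Bij⇒Permutation I.σE-bij ∘ₚ Bij⇒Permutation R.edge-bij)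
  ; fl = I.fl
  ; src-ok = λ x → trans (R.src-ok (I.σE x)) (cong R.vertex (I.src-ok x))
  ; tgt-ok = λ x → trans (R.tgt-ok (I.σE x)) (cong R.vertex (I.tgt-ok x))
  ; τ = (π ⟨$⟩ʳ_) ∘ I.τ ; τ-bij = Permutation⇒Bij (Bij⇒Permutation I.τ-bij ∘ₚ π)
  ; face-ok = λ j → subst₂ SameFace (sym (map-∘ (lookup X.faces j))) (sym (π-lookup (I.τ j)))
                                    (SameFace-map (renTrav R.edge) (λ _ → refl) (I.face-ok j)) }
  where
  module X = Complex X
  module D = Complex D
  module I = Iso I
  module R = Relabelling R
  relabelled = lookup-map≡ (renFace R.edge) D.faces R.faces-ok
  π = proj₁ relabelled
  π-lookup = proj₂ relabelled

Iso-refl : ∀ C → Iso C C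
Iso-refl C = record
  { σV = _ ; σV-bij = Permutation⇒Bij idₚ ; σE = _ ; σE-bij = Permutation⇒Bij idₚ
  ; fl = λ _ → false ; src-ok = λ _ → refl ; tgt-ok = λ _ → refl
  ; τ = _ ; τ-bij = Permutation⇒Bij idₚ
  ; face-ok = λ j → 0 , inj₁ (trans (++-identityʳ _) (map-id (lookup (Complex.faces C) j))) }

measure-Relabelling : ∀ {D C} → Relabelling D C → measure D ≡ measure C
measure-Relabelling {D} R = measure-Iso (Iso-relabel (Iso-refl D) R)

Relabelling-refl : ∀ C → Relabelling C C
Relabelling-refl C = record
  { vertex = _ ; vertex-bij = Permutation⇒Bij idₚ ; edge = _ ; edge-bij = Permutation⇒Bij idₚ
  ; src-ok = λ _ → refl ; tgt-ok = λ _ → refl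
  ; faces-ok = trans (map-cong map-id (Complex.faces C)) (map-id (Complex.faces C)) }

Relabelling-trans : ∀ {X Y Z} → Relabelling X Y → Relabelling Y Z → Relabelling X Z
Relabelling-trans {X} R₁ R₂ = record
  { vertex = R₂.vertex ∘ R₁.vertex
  ; vertex-bij = Permutation⇒Bij (Bij⇒Permutation R₁.vertex-bij ∘ₚ Bij⇒Permutation R₂.vertex-bij)
  ; edge = R₂.edge ∘ R₁.edge
  ; edge-bij = Permutation⇒Bij (Bij⇒Permutation R₁.edge-bij ∘ₚ Bij⇒Permutation R₂.edge-bij)
  ; src-ok = λ x → trans (R₂.src-ok (R₁.edge x)) (cong R₂.vertex (R₁.src-ok x))
  ; tgt-ok = λ x → trans (R₂.tgt-ok (R₁.edge x)) (cong R₂.vertex (R₁.tgt-ok x))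
  ; faces-ok = trans (map-cong map-∘ X.faces)
                     (trans (map-∘ X.faces) (trans (cong (map (renFace R₂.edge)) R₁.faces-ok) R₂.faces-ok)) }
  where
  module X = Complex X
  module R₁ = Relabelling R₁
  module R₂ = Relabelling R₂

step-decreases-or-relabels : ∀ {C D} → Step C D → measure D <ₗₑₓ measure C ⊎ Relabelling D C
step-decreases-or-relabels (contractEdge r)  = inj₁ (contractEdge-decreases r)
step-decreases-or-relabels (deleteFace r)    = inj₁ (deleteFace-decreases r)
step-decreases-or-relabels (contractFace1 r) = inj₁ (contractFace1-decreases r)
step-decreases-or-relabels (contractFace2 r) = inj₁ (contractFace2-decreases r)
step-decreases-or-relabels (splitVertex r)   = splitVertex-decreases-or-relabels r
step-decreases-or-relabels (topDelete r)     = topDelete-decreases-or-relabels r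

steps-decrease-or-relabel : ∀ {C D} → Star Step C D → measure D <ₗₑₓ measure C ⊎ Relabelling D C
steps-decrease-or-relabel {C} ε = inj₂ (Relabelling-refl C)
steps-decrease-or-relabel {C} {D} (s ◅ ss) with step-decreases-or-relabels s | steps-decrease-or-relabel ss
... | inj₁ C₁<C | inj₁ D<C₁ = inj₁ (<ₗₑₓ-trans D<C₁ C₁<C)
... | inj₁ C₁<C | inj₂ R    = inj₁ (subst (_<ₗₑₓ measure C) (sym (measure-Relabelling R)) C₁<C)
... | inj₂ R    | inj₁ D<C₁ = inj₁ (subst (measure D <ₗₑₓ_) (measure-Relabelling R) D<C₁)
... | inj₂ R₁   | inj₂ R₂   = inj₂ (Relabelling-trans R₂ R₁)

≼⇒<ₗₑₓ⊎≽ : ∀ {C D} → D ≼ C → measure D <ₗₑₓ measure C ⊎ C ≼ D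
≼⇒<ₗₑₓ⊎≽ {C} {D} (C′ , steps , iso) with steps-decrease-or-relabel steps
... | inj₁ C′<C = inj₁ (subst (_<ₗₑₓ measure C) (measure-Iso iso) C′<C)
... | inj₂ R    = inj₂ (D , ε , Iso-relabel (Iso-sym iso) R)

≺⇒<ₗₑₓ : ∀ {C D} → D ≺ C → measure D <ₗₑₓ measure C
≺⇒<ₗₑₓ (D≼C , C⋠D) with ≼⇒<ₗₑₓ⊎≽ D≼C
... | inj₁ D<C = D<C
... | inj₂ C≼D = contradiction C≼D C⋠D

wellFounded⇒noDescendingChain : ∀ {a ℓ} {A : Set a} {_<_ : Rel A ℓ} → WellFounded _<_ →
                                 (f : ℕ → A) → ¬ (∀ n → f (suc n) < f n)
wellFounded⇒noDescendingChain {_<_ = _<_} wf f descending = noChainFrom 0 (wf (f 0))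
  where
  noChainFrom : ∀ n → Acc _<_ (f n) → ⊥
  noChainFrom n (acc rs) = noChainFrom (suc n) (rs (descending n))

mainTheorem13 : ¬ (Σ (ℕ → Complex) λ c → ∀ n → c (suc n) ≺ c n)
mainTheorem13 (c , descending) =
  wellFounded⇒noDescendingChain <ₗₑₓ-wellFounded (measure ∘ c) (≺⇒<ₗₑₓ ∘ descending)
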